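{- Let $M=(m_i)_{i=0}^{\infty}$ be a sequence of integers with $m_0=1$ and $m_i\ge 2$ for $i\ge 1$, and put $M_i=\prod_{j=0}^{i}m_j$. For an integer $a\ge 0$ let $f(a,t)=\frac{t^{a}-1}{t-1}\in\mathbb{Z}[t]$. For a positive integer $h$ define \[ g_h(t):=\gcd\big(t^{m_1+m_2-1}f(m_2,t^{m_1-1}),\ t^{m_2+m_3-1}f(m_3,t^{m_2-1}),\ \ldots,\ t^{m_h+m_{h+1}-1}f(m_{h+1},t^{m_h-1})\big). \] Let $n\in\mathbb{N}$ and let $n=a_0+a_1M_1+\cdots+a_kM_k$ be its $M$-ary representation, i.e. $a_j\in\{0,1,\ldots,m_{j+1}-1\}$ for every $j$. Then \[ p_M(n,t)\equiv t^{a_0}\prod_{j=1}^{k}t^{a_j}f(a_j+1,t^{m_j-1}) \pmod{g_k(t)}. \]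
   Context: The $M$-ary partition polynomials $p_M(n,t)\in\mathbb{Z}[t]$ are defined by the power series expansion $\prod_{j=0}^{\infty}\frac{1}{1-tq^{M_j}}=\sum_{n=0}^{\infty}p_M(n,t)q^n$. For monic polynomials $f_1,f_2\in\mathbb{Z}[x]$, $\gcd(f_1,f_2)$ denotes a (monic) polynomial of highest possible degree dividing both, and $\gcd(f_1,\ldots,f_k):=\gcd(\gcd(f_1,\ldots,f_{k-1}),f_k)$. Congruence modulo a polynomial $g$ means the difference is divisible by $g$ in $\mathbb{Z}[t]$. -}

module Defs where

open import Data.Nat as ℕ using (ℕ; zero; suc; _≤_; _<_; _≤?_; _∸_)
open import Data.Integer as ℤ using (ℤ; +_; 0ℤ; 1ℤ)
open import Data.List using (List; []; _∷_; map; replicate)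
open import Data.Product using (Σ; _×_)
open import Data.Empty using (⊥)
open import Relation.Binary.PropositionalEquality using (_≡_)
open import Relation.Nullary using (does)
open import Data.Bool using (if_then_else_)

-- Polynomials in ℤ[t] as coefficient lists (lowest degree first).
-- Trailing zeros are allowed; equality is coefficientwise (_≈ₚ_).

Poly : Set
Poly = List ℤ

coeff : Poly → ℕ → ℤ
coeff []      _       = 0ℤ
coeff (c ∷ p) zero    = c
coeff (c ∷ p) (suc i) = coeff p i

_≈ₚ_ : Poly → Poly → Set
p ≈ₚ q = ∀ i → coeff p i ≡ coeff q i

infixl 6 _+ₚ_ _-ₚ_
infixl 7 _*ₚ_

_+ₚ_ : Poly → Poly → Poly
[]      +ₚ q       = q
(a ∷ p) +ₚ []      = a ∷ p
(a ∷ p) +ₚ (b ∷ q) = (a ℤ.+ b) ∷ (p +ₚ q)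

negₚ : Poly → Poly
negₚ = map (λ x → ℤ.- x)

_-ₚ_ : Poly → Poly → Poly
p -ₚ q = p +ₚ negₚ q

scaleₚ : ℤ → Poly → Poly
scaleₚ c = map (c ℤ.*_)

_*ₚ_ : Poly → Poly → Poly
[]      *ₚ q = []
(a ∷ p) *ₚ q = scaleₚ a q +ₚ (0ℤ ∷ (p *ₚ q))

oneₚ : Poly
oneₚ = 1ℤ ∷ []

zeroₚ : Poly
zeroₚ = []

tₚ : Poly
tₚ = 0ℤ ∷ 1ℤ ∷ []

_^ₚ_ : Poly → ℕ → Poly
p ^ₚ zero  = oneₚ
p ^ₚ suc n = p *ₚ (p ^ₚ n)

_∘ₚ_ : Poly → Poly → Poly
[]      ∘ₚ q = []
(c ∷ p) ∘ₚ q = (c ∷ []) +ₚ q *ₚ (p ∘ₚ q)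

_∣ₚ_ : Poly → Poly → Set
g ∣ₚ p = Σ Poly (λ h → (g *ₚ h) ≈ₚ p)

_≡_[modₚ_] : Poly → Poly → Poly → Set
p ≡ q [modₚ g ] = g ∣ₚ (p -ₚ q)

MonicDeg : ℕ → Poly → Set
MonicDeg d p = (coeff p d ≡ 1ℤ) × (∀ i → d < i → coeff p i ≡ 0ℤ)

IsGcd₁ : Poly → Poly → Set
IsGcd₁ g f = Σ ℕ λ d → MonicDeg d g × g ∣ₚ f ×
  (∀ e h → MonicDeg e h → h ∣ₚ f → e ≤ d)

IsGcd₂ : Poly → Poly → Poly → Set
IsGcd₂ g f₁ f₂ = Σ ℕ λ d → MonicDeg d g × g ∣ₚ f₁ × g ∣ₚ f₂ ×
  (∀ e h → MonicDeg e h → h ∣ₚ f₁ → h ∣ₚ f₂ → e ≤ d)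

-- IsGcdTo F h g : g is gcd(F 1, …, F h), with the iterated convention
-- gcd(f₁,…,f_k) = gcd(gcd(f₁,…,f_{k-1}), f_k).  (Only h ≥ 1 meaningful.)
IsGcdTo : (ℕ → Poly) → ℕ → Poly → Set
IsGcdTo F zero          g = ⊥
IsGcdTo F (suc zero)    g = IsGcd₁ g (F 1)
IsGcdTo F (suc (suc h)) g =
  Σ Poly λ g′ → IsGcdTo F (suc h) g′ × IsGcd₂ g g′ (F (suc (suc h)))

sumₚ : ℕ → (ℕ → Poly) → Poly
sumₚ zero    F = zeroₚ
sumₚ (suc n) F = sumₚ n F +ₚ F n

prod1ₚ : ℕ → (ℕ → Poly) → Poly
prod1ₚ zero    F = oneₚ
prod1ₚ (suc k) F = prod1ₚ k F *ₚ F (suc k)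

sumℕ≤ : ℕ → (ℕ → ℕ) → ℕ
sumℕ≤ zero    F = F 0
sumℕ≤ (suc k) F = sumℕ≤ k F ℕ.+ F (suc k)

-- f(a,t) = (t^a - 1)/(t - 1) = 1 + t + ⋯ + t^{a-1}
fₚ : ℕ → Poly
fₚ a = replicate a 1ℤ

Mseq : (ℕ → ℕ) → ℕ → ℕ
Mseq m zero    = m 0
Mseq m (suc i) = Mseq m i ℕ.* m (suc i)

-- P m j n = coefficient of q^n in ∏_{i<j} 1/(1 - t q^{M_i})
--         = ∏_{i<j} Σ_c t^c q^{c M_i}, extracted coefficientwise.
P : (ℕ → ℕ) → ℕ → ℕ → Poly
P m zero    zero    = oneₚ
P m zero    (suc n) = zeroₚ
P m (suc j) n = sumₚ (suc n) λ c →
  if does (c ℕ.* Mseq m j ≤? n)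
  then (tₚ ^ₚ c) *ₚ P m j (n ∸ c ℕ.* Mseq m j)
  else zeroₚ

-- p_M(n,t): the factors with index j > n have M_j ≥ 2^j > n (under the
-- standing hypotheses) and only contribute their constant term 1.
pM : (ℕ → ℕ) → ℕ → Poly
pM m n = P m (suc n) n

gArg : (ℕ → ℕ) → ℕ → Poly
gArg m h = (tₚ ^ₚ (m h ℕ.+ m (suc h) ∸ 1)) *ₚ (fₚ (m (suc h)) ∘ₚ (tₚ ^ₚ (m h ∸ 1)))

{-# OPTIONS --safe #-}
module Submission where

-- Write h_μ(b) = t^b f(b+1, t^(μ-1)) = Σ_{c ≤ b} t^c (t^μ)^(b-c), and let P_j be the
-- partition polynomials using only the parts M_0, …, M_{j-1}.  Peeling off the largest
-- part M_j gives P_{j+1}(r + b M_j) = Σ_{c ≤ b} t^c P_j(r + (b-c) M_j) when r < M_j, so a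
-- congruence P_j(r + l M_j) ≡ E (t^{m_j})^l for all l propagates to
-- P_{j+1}(r + b M_j) ≡ E h_{m_j}(b).  Since h_μ(N + ν) - t^ν h_μ(N) is a multiple of
-- t^(μ+ν-1) f(ν, t^(μ-1)), modulo the h-th argument of g_k the factor h_{m_h} is periodic:
-- h_{m_h}(a + l m_{h+1}) ≡ (t^{m_{h+1}})^l h_{m_h}(a).  As M_{h+1} = M_h m_{h+1}, this is
-- again a congruence of the first kind, and induction on the number of digits gives the
-- product formula for P_{k+1}(n).  Finally p_M(n) = P_{k+1}(n), as no part M_j with j > k
-- is at most n.

open import Defs
open import Data.Nat using (ℕ; suc; _≤_; _<_; _*_; _+_; _∸_)
open import Relation.Binary.PropositionalEquality using (_≡_)

open import Algebra.Bundles using (CommutativeRing)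
import Algebra.Consequences.Setoid as Consequences
open import Algebra.Structures using (IsMagma)
open import Data.Bool using (if_then_else_)
open import Data.Integer as ℤ using (ℤ; 0ℤ; 1ℤ) renaming (_+_ to _+ℤ_; _*_ to _*ℤ_; -_ to -ℤ_)
import Data.Integer.Properties as ℤP
open import Data.List using ([]; _∷_; map)
open import Data.Maybe using (Maybe; just; nothing)
open import Data.Nat using (zero; z≤n; s≤s; _≤′_; ≤′-reflexive; ≤′-step; _≤?_; >-nonZero)
import Data.Nat.Properties as ℕP
open import Data.Nat.Tactic.RingSolver as ℕ-Solver using ()
open import Data.Product using (_,_)
open import Data.Sum using (inj₁; inj₂; [_,_]′)
open import Function using (_∘_)
open import Level using (0ℓ)
open import Relation.Binary.Bundles using (Setoid; Preorder)
open import Relation.Binary.Core using (Rel)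
open import Relation.Binary.PropositionalEquality as ≡ using (refl; cong; cong₂)
import Relation.Binary.Reasoning.Preorder as PreorderReasoning
import Relation.Binary.Reasoning.Setoid as SetoidReasoning
open import Relation.Binary.Structures using (IsEquivalence)
open import Relation.Nullary using (does; yes)
open import Relation.Nullary.Decidable using (dec-true; dec-false)
open import Tactic.RingSolver.Core.AlmostCommutativeRing
  using (AlmostCommutativeRing; fromCommutativeRing)

-- The commutative ring ℤ[t]

-- A record rather than Defs._≈ₚ_, so that p and q can be inferred from a proof.
infix 4 _≈_
record _≈_ (p q : Poly) : Set where
  constructor coeffwise
  field coeff-≡ : ∀ i → coeff p i ≡ coeff q i
open _≈_

≈-isEquivalence : IsEquivalence _≈_
≈-isEquivalence = record
  { refl  = coeffwise λ _ → refl
  ; sym   = λ p≈q → coeffwise (≡.sym ∘ coeff-≡ p≈q)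
  ; trans = λ p≈q q≈r → coeffwise λ i → ≡.trans (coeff-≡ p≈q i) (coeff-≡ q≈r i)
  }

≈-setoid : Setoid 0ℓ 0ℓ
≈-setoid = record { isEquivalence = ≈-isEquivalence }

open Setoid ≈-setoid using ()
  renaming (refl to ≈-refl; sym to ≈-sym; trans to ≈-trans; reflexive to ≈-reflexive)
open Consequences ≈-setoid using (comm∧assoc⇒middleFour; comm∧invˡ⇒inv; comm∧idˡ⇒id; comm∧distrʳ⇒distr)

coeff-+ : ∀ p q i → coeff (p +ₚ q) i ≡ coeff p i +ℤ coeff q i
coeff-+ []      q       i       = ≡.sym (ℤP.+-identityˡ (coeff q i))
coeff-+ (a ∷ p) []      i       = ≡.sym (ℤP.+-identityʳ (coeff (a ∷ p) i))
coeff-+ (a ∷ p) (b ∷ q) zero    = refl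
coeff-+ (a ∷ p) (b ∷ q) (suc i) = coeff-+ p q i

coeff-map : ∀ (f : ℤ → ℤ) → f 0ℤ ≡ 0ℤ → ∀ p i → coeff (map f p) i ≡ f (coeff p i)
coeff-map f f0≡0 []      i       = ≡.sym f0≡0
coeff-map f f0≡0 (a ∷ p) zero    = refl
coeff-map f f0≡0 (a ∷ p) (suc i) = coeff-map f f0≡0 p i

coeff-neg : ∀ p i → coeff (negₚ p) i ≡ -ℤ coeff p i
coeff-neg = coeff-map -ℤ_ refl

coeff-scale : ∀ c p i → coeff (scaleₚ c p) i ≡ c *ℤ coeff p i
coeff-scale c = coeff-map (c *ℤ_) (ℤP.*-zeroʳ c)

∷-cong : ∀ {a b p q} → a ≡ b → p ≈ q → a ∷ p ≈ b ∷ q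
∷-cong a≡b p≈q = coeffwise λ { zero → a≡b ; (suc i) → coeff-≡ p≈q i }

0∷[]≈[] : 0ℤ ∷ [] ≈ []
0∷[]≈[] = coeffwise λ { zero → refl ; (suc i) → refl }

+-cong : ∀ {p p′ q q′} → p ≈ p′ → q ≈ q′ → p +ₚ q ≈ p′ +ₚ q′
+-cong {p} {p′} {q} {q′} p≈p′ q≈q′ = coeffwise λ i → begin
  coeff (p +ₚ q) i          ≡⟨ coeff-+ p q i ⟩
  coeff p i +ℤ coeff q i    ≡⟨ cong₂ _+ℤ_ (coeff-≡ p≈p′ i) (coeff-≡ q≈q′ i) ⟩
  coeff p′ i +ℤ coeff q′ i  ≡⟨ coeff-+ p′ q′ i ⟨
  coeff (p′ +ₚ q′) i        ∎
  where open ≡.≡-Reasoning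

+-congˡ : ∀ r {p q} → p ≈ q → r +ₚ p ≈ r +ₚ q
+-congˡ r = +-cong ≈-refl

+-comm : ∀ p q → p +ₚ q ≈ q +ₚ p
+-comm p q = coeffwise λ i → begin
  coeff (p +ₚ q) i        ≡⟨ coeff-+ p q i ⟩
  coeff p i +ℤ coeff q i  ≡⟨ ℤP.+-comm (coeff p i) (coeff q i) ⟩
  coeff q i +ℤ coeff p i  ≡⟨ coeff-+ q p i ⟨
  coeff (q +ₚ p) i        ∎
  where open ≡.≡-Reasoning

+-assoc : ∀ p q r → (p +ₚ q) +ₚ r ≈ p +ₚ (q +ₚ r)
+-assoc p q r = coeffwise λ i → begin
  coeff ((p +ₚ q) +ₚ r) i                 ≡⟨ coeff-+ (p +ₚ q) r i ⟩
  coeff (p +ₚ q) i +ℤ coeff r i           ≡⟨ cong (_+ℤ coeff r i) (coeff-+ p q i) ⟩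
  (coeff p i +ℤ coeff q i) +ℤ coeff r i   ≡⟨ ℤP.+-assoc (coeff p i) (coeff q i) (coeff r i) ⟩
  coeff p i +ℤ (coeff q i +ℤ coeff r i)   ≡⟨ cong (coeff p i +ℤ_) (coeff-+ q r i) ⟨
  coeff p i +ℤ coeff (q +ₚ r) i           ≡⟨ coeff-+ p (q +ₚ r) i ⟨
  coeff (p +ₚ (q +ₚ r)) i                 ∎
  where open ≡.≡-Reasoning

+-identityʳ : ∀ p → p +ₚ [] ≈ p
+-identityʳ []      = ≈-refl
+-identityʳ (a ∷ p) = ≈-refl

+-middleFour : ∀ w x y z → (w +ₚ x) +ₚ (y +ₚ z) ≈ (w +ₚ y) +ₚ (x +ₚ z)
+-middleFour = comm∧assoc⇒middleFour +-cong +-comm +-assoc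

neg-cong : ∀ {p q} → p ≈ q → negₚ p ≈ negₚ q
neg-cong {p} {q} p≈q = coeffwise λ i →
  ≡.trans (coeff-neg p i) (≡.trans (cong -ℤ_ (coeff-≡ p≈q i)) (≡.sym (coeff-neg q i)))

neg-inverseˡ : ∀ p → negₚ p +ₚ p ≈ []
neg-inverseˡ p = coeffwise λ i → begin
  coeff (negₚ p +ₚ p) i          ≡⟨ coeff-+ (negₚ p) p i ⟩
  coeff (negₚ p) i +ℤ coeff p i  ≡⟨ cong (_+ℤ coeff p i) (coeff-neg p i) ⟩
  -ℤ coeff p i +ℤ coeff p i      ≡⟨ ℤP.+-inverseˡ (coeff p i) ⟩
  0ℤ                             ∎
  where open ≡.≡-Reasoning

scale-cong : ∀ c {p q} → p ≈ q → scaleₚ c p ≈ scaleₚ c q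
scale-cong c {p} {q} p≈q = coeffwise λ i →
  ≡.trans (coeff-scale c p i) (≡.trans (cong (c *ℤ_) (coeff-≡ p≈q i)) (≡.sym (coeff-scale c q i)))

scale-zero : ∀ p → scaleₚ 0ℤ p ≈ []
scale-zero p = coeffwise λ i → ≡.trans (coeff-scale 0ℤ p i) (ℤP.*-zeroˡ (coeff p i))

scale-one : ∀ p → scaleₚ 1ℤ p ≈ p
scale-one p = coeffwise λ i → ≡.trans (coeff-scale 1ℤ p i) (ℤP.*-identityˡ (coeff p i))

scale-distribʳ : ∀ a b r → scaleₚ (a +ℤ b) r ≈ scaleₚ a r +ₚ scaleₚ b r
scale-distribʳ a b r = coeffwise λ i → begin
  coeff (scaleₚ (a +ℤ b) r) i                   ≡⟨ coeff-scale (a +ℤ b) r i ⟩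
  (a +ℤ b) *ℤ coeff r i                         ≡⟨ ℤP.*-distribʳ-+ (coeff r i) a b ⟩
  a *ℤ coeff r i +ℤ b *ℤ coeff r i              ≡⟨ cong₂ _+ℤ_ (coeff-scale a r i) (coeff-scale b r i) ⟨
  coeff (scaleₚ a r) i +ℤ coeff (scaleₚ b r) i  ≡⟨ coeff-+ (scaleₚ a r) (scaleₚ b r) i ⟨
  coeff (scaleₚ a r +ₚ scaleₚ b r) i            ∎
  where open ≡.≡-Reasoning

scale-distribˡ : ∀ a q r → scaleₚ a (q +ₚ r) ≈ scaleₚ a q +ₚ scaleₚ a r
scale-distribˡ a q r = coeffwise λ i → begin
  coeff (scaleₚ a (q +ₚ r)) i                   ≡⟨ coeff-scale a (q +ₚ r) i ⟩
  a *ℤ coeff (q +ₚ r) i                         ≡⟨ cong (a *ℤ_) (coeff-+ q r i) ⟩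
  a *ℤ (coeff q i +ℤ coeff r i)                 ≡⟨ ℤP.*-distribˡ-+ a (coeff q i) (coeff r i) ⟩
  a *ℤ coeff q i +ℤ a *ℤ coeff r i              ≡⟨ cong₂ _+ℤ_ (coeff-scale a q i) (coeff-scale a r i) ⟨
  coeff (scaleₚ a q) i +ℤ coeff (scaleₚ a r) i  ≡⟨ coeff-+ (scaleₚ a q) (scaleₚ a r) i ⟨
  coeff (scaleₚ a q +ₚ scaleₚ a r) i            ∎
  where open ≡.≡-Reasoning

scale-scale : ∀ a b r → scaleₚ a (scaleₚ b r) ≈ scaleₚ (a *ℤ b) r
scale-scale a b r = coeffwise λ i → begin
  coeff (scaleₚ a (scaleₚ b r)) i  ≡⟨ coeff-scale a (scaleₚ b r) i ⟩
  a *ℤ coeff (scaleₚ b r) i        ≡⟨ cong (a *ℤ_) (coeff-scale b r i) ⟩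
  a *ℤ (b *ℤ coeff r i)            ≡⟨ ℤP.*-assoc a b (coeff r i) ⟨
  a *ℤ b *ℤ coeff r i              ≡⟨ coeff-scale (a *ℤ b) r i ⟨
  coeff (scaleₚ (a *ℤ b) r) i      ∎
  where open ≡.≡-Reasoning

*-zeroʳ : ∀ p → p *ₚ [] ≈ []
*-zeroʳ []      = ≈-refl
*-zeroʳ (a ∷ p) = ≈-trans (∷-cong refl (*-zeroʳ p)) 0∷[]≈[]

*-congˡ : ∀ p {q q′} → q ≈ q′ → p *ₚ q ≈ p *ₚ q′
*-congˡ []      q≈q′ = ≈-refl
*-congˡ (a ∷ p) q≈q′ = +-cong (scale-cong a q≈q′) (∷-cong refl (*-congˡ p q≈q′))

*-identityˡ : ∀ p → oneₚ *ₚ p ≈ p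
*-identityˡ p = ≈-trans (+-cong (scale-one p) 0∷[]≈[]) (+-identityʳ p)

*-∷ʳ : ∀ p b q → p *ₚ (b ∷ q) ≈ scaleₚ b p +ₚ (0ℤ ∷ (p *ₚ q))
*-∷ʳ []      b q = ≈-sym 0∷[]≈[]
*-∷ʳ (a ∷ p) b q = ∷-cong (cong (_+ℤ 0ℤ) (ℤP.*-comm a b)) (begin
  scaleₚ a q +ₚ (p *ₚ (b ∷ q))                   ≈⟨ +-congˡ (scaleₚ a q) (*-∷ʳ p b q) ⟩
  scaleₚ a q +ₚ (scaleₚ b p +ₚ (0ℤ ∷ (p *ₚ q)))  ≈⟨ +-assoc (scaleₚ a q) (scaleₚ b p) _ ⟨
  (scaleₚ a q +ₚ scaleₚ b p) +ₚ (0ℤ ∷ (p *ₚ q))  ≈⟨ +-cong (+-comm (scaleₚ a q) (scaleₚ b p)) ≈-refl ⟩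
  (scaleₚ b p +ₚ scaleₚ a q) +ₚ (0ℤ ∷ (p *ₚ q))  ≈⟨ +-assoc (scaleₚ b p) (scaleₚ a q) _ ⟩
  scaleₚ b p +ₚ (scaleₚ a q +ₚ (0ℤ ∷ (p *ₚ q)))  ∎)
  where open SetoidReasoning ≈-setoid

*-comm : ∀ p q → p *ₚ q ≈ q *ₚ p
*-comm []      q = ≈-sym (*-zeroʳ q)
*-comm (a ∷ p) q = ≈-sym (≈-trans (*-∷ʳ q a p) (+-congˡ (scaleₚ a q) (∷-cong refl (*-comm q p))))

*-congʳ : ∀ r {p q} → p ≈ q → p *ₚ r ≈ q *ₚ r
*-congʳ r {p} {q} p≈q = ≈-trans (*-comm p r) (≈-trans (*-congˡ r p≈q) (*-comm r q))

*-cong : ∀ {p p′ q q′} → p ≈ p′ → q ≈ q′ → p *ₚ q ≈ p′ *ₚ q′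
*-cong {p} {p′} {q} {q′} p≈p′ q≈q′ = ≈-trans (*-congʳ q p≈p′) (*-congˡ p′ q≈q′)

*-distribʳ : ∀ r p q → (p +ₚ q) *ₚ r ≈ p *ₚ r +ₚ q *ₚ r
*-distribʳ r []      q       = ≈-refl
*-distribʳ r (a ∷ p) []      = ≈-sym (+-identityʳ _)
*-distribʳ r (a ∷ p) (b ∷ q) = ≈-trans
  (+-cong (scale-distribʳ a b r) (∷-cong refl (*-distribʳ r p q)))
  (+-middleFour (scaleₚ a r) (scaleₚ b r) (0ℤ ∷ (p *ₚ r)) (0ℤ ∷ (q *ₚ r)))

scale-*ˡ : ∀ a q r → scaleₚ a q *ₚ r ≈ scaleₚ a (q *ₚ r)
scale-*ˡ a []      r = ≈-refl
scale-*ˡ a (b ∷ q) r = ≈-trans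
  (+-cong (≈-sym (scale-scale a b r)) (∷-cong (≡.sym (ℤP.*-zeroʳ a)) (scale-*ˡ a q r)))
  (≈-sym (scale-distribˡ a (scaleₚ b r) (0ℤ ∷ (q *ₚ r))))

0∷-*ˡ : ∀ p q → (0ℤ ∷ p) *ₚ q ≈ 0ℤ ∷ (p *ₚ q)
0∷-*ˡ p q = +-cong (scale-zero q) ≈-refl

*-assoc : ∀ p q r → (p *ₚ q) *ₚ r ≈ p *ₚ (q *ₚ r)
*-assoc []      q r = ≈-refl
*-assoc (a ∷ p) q r = ≈-trans (*-distribʳ r (scaleₚ a q) (0ℤ ∷ (p *ₚ q)))
  (+-cong (scale-*ˡ a q r) (≈-trans (0∷-*ˡ (p *ₚ q) r) (∷-cong refl (*-assoc p q r))))

ℤ[t]-commutativeRing : CommutativeRing 0ℓ 0ℓ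
ℤ[t]-commutativeRing = record
  { Carrier           = Poly
  ; _≈_               = _≈_
  ; _+_               = _+ₚ_
  ; _*_               = _*ₚ_
  ; -_                = negₚ
  ; 0#                = []
  ; 1#                = oneₚ
  ; isCommutativeRing = record
    { isRing = record
      { +-isAbelianGroup = record
        { isGroup = record
          { isMonoid = record
            { isSemigroup = record
              { isMagma = record { isEquivalence = ≈-isEquivalence ; ∙-cong = +-cong }
              ; assoc   = +-assoc
              }
            ; identity = (λ _ → ≈-refl) , +-identityʳ
            }
          ; inverse = comm∧invˡ⇒inv +-comm neg-inverseˡ
          ; ⁻¹-cong = neg-cong
          }
        ; comm = +-comm
        }
      ; *-cong     = *-cong
      ; *-assoc    = *-assoc
      ; *-identity = comm∧idˡ⇒id *-comm *-identityˡ
      ; distrib    = comm∧distrʳ⇒distr +-cong *-comm *-distribʳ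
      }
    ; *-comm = *-comm
    }
  }

open CommutativeRing ℤ[t]-commutativeRing using (+-isMagma; *-identityʳ) renaming (distribˡ to *-distribˡ)

-- The solver compares constants syntactically, so every representation of 0
-- (such as 0ℤ ∷ [], the value of 1 - 1) must be recognised as zero.
ℤ[t]-almostCommutativeRing : AlmostCommutativeRing 0ℓ 0ℓ
ℤ[t]-almostCommutativeRing = fromCommutativeRing ℤ[t]-commutativeRing []≈?
  where
  []≈? : ∀ p → Maybe ([] ≈ p)
  []≈? []      = just ≈-refl
  []≈? (a ∷ p) with a ℤ.≟ 0ℤ | []≈? p
  ... | yes refl | just []≈p = just (≈-trans (≈-sym 0∷[]≈[]) (∷-cong refl []≈p))
  ... | _        | _         = nothing

open import Tactic.RingSolver.NonReflective ℤ[t]-almostCommutativeRing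
  using (solve; _⊜_; _⊕_; _⊗_; ⊝_; Κ)

*-swap : ∀ x y z → x *ₚ (y *ₚ z) ≈ y *ₚ (x *ₚ z)
*-swap = solve 3 (λ x y z → x ⊗ (y ⊗ z) ⊜ (y ⊗ (x ⊗ z))) ≈-refl

^-distribˡ-+-* : ∀ p a b → p ^ₚ (a + b) ≈ p ^ₚ a *ₚ p ^ₚ b
^-distribˡ-+-* p zero    b = ≈-sym (*-identityˡ _)
^-distribˡ-+-* p (suc a) b = ≈-trans (*-congˡ p (^-distribˡ-+-* p a b)) (≈-sym (*-assoc p _ _))

^-*-assoc : ∀ p μ l → (p ^ₚ μ) ^ₚ l ≈ p ^ₚ (l * μ)
^-*-assoc p μ zero    = ≈-refl
^-*-assoc p μ (suc l) = ≈-trans (*-congˡ (p ^ₚ μ) (^-*-assoc p μ l)) (≈-sym (^-distribˡ-+-* p μ (l * μ)))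

module _ {ℓ} {_∼_ : Rel Poly ℓ} (isMagma : IsMagma _∼_ _+ₚ_) where
  open IsMagma isMagma using (∙-cong) renaming (refl to ∼-refl)

  sumₚ-cong : ∀ n {F G : ℕ → Poly} → (∀ c → c < n → F c ∼ G c) → sumₚ n F ∼ sumₚ n G
  sumₚ-cong zero    F∼G = ∼-refl
  sumₚ-cong (suc n) F∼G = ∙-cong (sumₚ-cong n (λ c c<n → F∼G c (ℕP.m<n⇒m<1+n c<n))) (F∼G n ℕP.≤-refl)

*-distribˡ-sumₚ : ∀ X n F → X *ₚ sumₚ n F ≈ sumₚ n (λ c → X *ₚ F c)
*-distribˡ-sumₚ X zero    F = *-zeroʳ X
*-distribˡ-sumₚ X (suc n) F = ≈-trans (*-distribˡ X (sumₚ n F) (F n)) (+-cong (*-distribˡ-sumₚ X n F) ≈-refl)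

sumₚ-zero-tail : ∀ {b n F} → b ≤′ n → (∀ c → b ≤ c → c < n → F c ≈ []) → sumₚ n F ≈ sumₚ b F
sumₚ-zero-tail (≤′-reflexive refl) _ = ≈-refl
sumₚ-zero-tail {b} {suc n} {F} (≤′-step b≤′n) F≈[] = ≈-trans
  (+-cong (sumₚ-zero-tail b≤′n λ c b≤c c<n → F≈[] c b≤c (ℕP.m<n⇒m<1+n c<n)) (F≈[] n (ℕP.≤′⇒≤ b≤′n) ℕP.≤-refl))
  (+-identityʳ (sumₚ b F))

-- Divisibility and congruence modulo a polynomial

infix 4 _∣_
record _∣_ (g p : Poly) : Set where
  constructor divides
  field
    quotient  : Poly
    ≈-product : g *ₚ quotient ≈ p

∣ₚ⇒∣ : ∀ {g p} → g ∣ₚ p → g ∣ p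
∣ₚ⇒∣ (w , gw≈p) = divides w (coeffwise gw≈p)

∣-trans : ∀ {f g h} → f ∣ g → g ∣ h → f ∣ h
∣-trans {f} {g} {h} (divides u fu≈g) (divides v gv≈h) = divides (u *ₚ v) (begin
  f *ₚ (u *ₚ v)  ≈⟨ *-assoc f u v ⟨
  (f *ₚ u) *ₚ v  ≈⟨ *-congʳ v fu≈g ⟩
  g *ₚ v         ≈⟨ gv≈h ⟩
  h              ∎)
  where open SetoidReasoning ≈-setoid

IsGcdTo⇒∣ : ∀ {F} k {g} → IsGcdTo F k g → ∀ h → 1 ≤ h → h ≤ k → g ∣ F h
IsGcdTo⇒∣ (suc zero)    (_ , _ , g∣F₁ , _) (suc zero)    _ _        = ∣ₚ⇒∣ g∣F₁
IsGcdTo⇒∣ (suc zero)    _                  (suc (suc h)) _ (s≤s ())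
IsGcdTo⇒∣ (suc (suc k)) (g′ , gcd′ , _ , _ , g∣g′ , g∣F , _) h 1≤h h≤k+2 =
  [ (λ h<k+2 → ∣-trans (∣ₚ⇒∣ g∣g′) (IsGcdTo⇒∣ (suc k) gcd′ h 1≤h (ℕP.≤-pred h<k+2)))
  , (λ { refl → ∣ₚ⇒∣ g∣F })
  ]′ (ℕP.m≤n⇒m<n∨m≡n h≤k+2)

-- Defs._≡_[modₚ_] with the difference p - q moved to the other side, which keeps the
-- bookkeeping below within reach of the ring solver.
infix 4 _≈_[mod_]
record _≈_[mod_] (p q g : Poly) : Set where
  constructor by-multiple
  field
    factor   : Poly
    ≈-factor : p ≈ q +ₚ g *ₚ factor

≈[mod]⇒≡[modₚ] : ∀ {p q g} → p ≈ q [mod g ] → p ≡ q [modₚ g ]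
≈[mod]⇒≡[modₚ] {p} {q} {g} (by-multiple k p≈q+gk) =
  k , coeff-≡ (≈-trans (cancel q g k) (+-cong (≈-sym p≈q+gk) ≈-refl))
  where
  cancel : ∀ q g k → g *ₚ k ≈ (q +ₚ g *ₚ k) -ₚ q
  cancel = solve 3 (λ q g k → g ⊗ k ⊜ ((q ⊕ g ⊗ k) ⊕ ⊝ q)) ≈-refl

module _ {g : Poly} where

  ≈⇒≈[mod] : ∀ {p q} → p ≈ q → p ≈ q [mod g ]
  ≈⇒≈[mod] {p} {q} p≈q =
    by-multiple [] (≈-trans p≈q (≈-sym (≈-trans (+-congˡ q (*-zeroʳ g)) (+-identityʳ q))))

  ≈[mod]-sym : ∀ {p q} → p ≈ q [mod g ] → q ≈ p [mod g ]
  ≈[mod]-sym {p} {q} (by-multiple k p≈q+gk) =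
    by-multiple (negₚ k) (≈-trans (shift q g k) (+-cong (≈-sym p≈q+gk) ≈-refl))
    where
    shift : ∀ q g k → q ≈ (q +ₚ g *ₚ k) +ₚ g *ₚ negₚ k
    shift = solve 3 (λ q g k → q ⊜ ((q ⊕ g ⊗ k) ⊕ g ⊗ ⊝ k)) ≈-refl

  ≈[mod]-trans : ∀ {p q r} → p ≈ q [mod g ] → q ≈ r [mod g ] → p ≈ r [mod g ]
  ≈[mod]-trans {p} {q} {r} (by-multiple k p≈q+gk) (by-multiple l q≈r+gl) =
    by-multiple (l +ₚ k) (≈-trans p≈q+gk (≈-trans (+-cong q≈r+gl ≈-refl) (collect r g l k)))
    where
    collect : ∀ r g l k → (r +ₚ g *ₚ l) +ₚ g *ₚ k ≈ r +ₚ g *ₚ (l +ₚ k)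
    collect = solve 4 (λ r g l k → (r ⊕ g ⊗ l) ⊕ g ⊗ k ⊜ (r ⊕ g ⊗ (l ⊕ k))) ≈-refl

  +-cong-mod : ∀ {p p′ q q′} → p ≈ p′ [mod g ] → q ≈ q′ [mod g ] → p +ₚ q ≈ p′ +ₚ q′ [mod g ]
  +-cong-mod {p} {p′} {q} {q′} (by-multiple k p≈p′+gk) (by-multiple l q≈q′+gl) =
    by-multiple (k +ₚ l) (≈-trans (+-cong p≈p′+gk q≈q′+gl) (collect p′ q′ g k l))
    where
    collect : ∀ p q g k l → (p +ₚ g *ₚ k) +ₚ (q +ₚ g *ₚ l) ≈ (p +ₚ q) +ₚ g *ₚ (k +ₚ l)
    collect = solve 5 (λ p q g k l → (p ⊕ g ⊗ k) ⊕ (q ⊕ g ⊗ l) ⊜ ((p ⊕ q) ⊕ g ⊗ (k ⊕ l))) ≈-refl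

  *-congˡ-mod : ∀ c {p q} → p ≈ q [mod g ] → c *ₚ p ≈ c *ₚ q [mod g ]
  *-congˡ-mod c {p} {q} (by-multiple k p≈q+gk) =
    by-multiple (c *ₚ k) (≈-trans (*-congˡ c p≈q+gk) (expand c q g k))
    where
    expand : ∀ c q g k → c *ₚ (q +ₚ g *ₚ k) ≈ c *ₚ q +ₚ g *ₚ (c *ₚ k)
    expand = solve 4 (λ c q g k → c ⊗ (q ⊕ g ⊗ k) ⊜ (c ⊗ q ⊕ g ⊗ (c ⊗ k))) ≈-refl

  +-multiple-mod : ∀ {d} → g ∣ d → ∀ p c → p +ₚ c *ₚ d ≈ p [mod g ]
  +-multiple-mod {d} (divides w gw≈d) p c =
    by-multiple (c *ₚ w) (≈-trans (+-congˡ p (*-congˡ c (≈-sym gw≈d))) (regroup p c g w))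
    where
    regroup : ∀ p c g w → p +ₚ c *ₚ (g *ₚ w) ≈ p +ₚ g *ₚ (c *ₚ w)
    regroup = solve 4 (λ p c g w → p ⊕ c ⊗ (g ⊗ w) ⊜ (p ⊕ g ⊗ (c ⊗ w))) ≈-refl

  ≈[mod]-preorder : Preorder 0ℓ 0ℓ 0ℓ
  ≈[mod]-preorder = record
    { isPreorder = record
      { isEquivalence = ≈-isEquivalence
      ; reflexive     = ≈⇒≈[mod]
      ; trans         = ≈[mod]-trans
      }
    }

  +-isMagma-mod : IsMagma (_≈_[mod g ]) _+ₚ_
  +-isMagma-mod = record
    { isEquivalence = record { refl = ≈⇒≈[mod] ≈-refl ; sym = ≈[mod]-sym ; trans = ≈[mod]-trans }
    ; ∙-cong        = +-cong-mod
    }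

-- The digit factors h_μ(b)

fₚ∘-+ : ∀ u x y → fₚ (x + y) ∘ₚ u ≈ fₚ x ∘ₚ u +ₚ u ^ₚ x *ₚ (fₚ y ∘ₚ u)
fₚ∘-+ u zero    y = ≈-sym (*-identityˡ _)
fₚ∘-+ u (suc x) y = ≈-trans (+-congˡ oneₚ (*-congˡ u (fₚ∘-+ u x y))) (regroup oneₚ u _ _ _)
  where
  regroup : ∀ o u A B C → o +ₚ u *ₚ (A +ₚ B *ₚ C) ≈ (o +ₚ u *ₚ A) +ₚ (u *ₚ B) *ₚ C
  regroup = solve 5 (λ o u A B C → o ⊕ u ⊗ (A ⊕ B ⊗ C) ⊜ ((o ⊕ u ⊗ A) ⊕ (u ⊗ B) ⊗ C)) ≈-refl

digitFactor : ℕ → ℕ → Poly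
digitFactor μ b = tₚ ^ₚ b *ₚ (fₚ (b + 1) ∘ₚ (tₚ ^ₚ (μ ∸ 1)))

sum≈digitFactor : ∀ μ → 1 ≤ μ → ∀ b → sumₚ (suc b) (λ c → tₚ ^ₚ c *ₚ (tₚ ^ₚ μ) ^ₚ (b ∸ c)) ≈ digitFactor μ b
sum≈digitFactor (suc μ₀) _ zero =
  *-congˡ oneₚ (≈-sym (≈-trans (+-congˡ oneₚ (*-zeroʳ (tₚ ^ₚ μ₀))) (+-identityʳ oneₚ)))
sum≈digitFactor (suc μ₀) 1≤μ (suc b) = begin
  sumₚ (suc b) (λ c → tₚ ^ₚ c *ₚ T ^ₚ (suc b ∸ c)) +ₚ tₚ ^ₚ suc b *ₚ T ^ₚ (b ∸ b)
    ≈⟨ +-cong (sumₚ-cong +-isMagma (suc b) pull-T)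
              (*-congˡ (tₚ ^ₚ suc b) (≈-reflexive (cong (T ^ₚ_) (ℕP.n∸n≡0 b)))) ⟩
  sumₚ (suc b) (λ c → T *ₚ (tₚ ^ₚ c *ₚ T ^ₚ (b ∸ c))) +ₚ tₚ ^ₚ suc b *ₚ oneₚ
    ≈⟨ +-cong (*-distribˡ-sumₚ T (suc b) _) ≈-refl ⟨
  T *ₚ sumₚ (suc b) (λ c → tₚ ^ₚ c *ₚ T ^ₚ (b ∸ c)) +ₚ tₚ ^ₚ suc b *ₚ oneₚ
    ≈⟨ +-cong (*-congˡ T (sum≈digitFactor (suc μ₀) 1≤μ b)) ≈-refl ⟩
  T *ₚ digitFactor (suc μ₀) b +ₚ tₚ ^ₚ suc b *ₚ oneₚ
    ≈⟨ regroup tₚ (tₚ ^ₚ b) (tₚ ^ₚ μ₀) (fₚ (b + 1) ∘ₚ (tₚ ^ₚ μ₀)) ⟩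
  digitFactor (suc μ₀) (suc b) ∎
  where
  open SetoidReasoning ≈-setoid
  T = tₚ ^ₚ suc μ₀
  pull-T : ∀ c → c < suc b → tₚ ^ₚ c *ₚ T ^ₚ (suc b ∸ c) ≈ T *ₚ (tₚ ^ₚ c *ₚ T ^ₚ (b ∸ c))
  pull-T c (s≤s c≤b) = ≈-trans (*-congˡ (tₚ ^ₚ c) (≈-reflexive (cong (T ^ₚ_) (ℕP.+-∸-assoc 1 c≤b))))
                               (*-swap (tₚ ^ₚ c) T (T ^ₚ (b ∸ c)))
  regroup : ∀ t tᵇ u F → (t *ₚ u) *ₚ (tᵇ *ₚ F) +ₚ (t *ₚ tᵇ) *ₚ oneₚ ≈ (t *ₚ tᵇ) *ₚ (oneₚ +ₚ u *ₚ F)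
  regroup = solve 4 (λ t tᵇ u F →
    (t ⊗ u) ⊗ (tᵇ ⊗ F) ⊕ (t ⊗ tᵇ) ⊗ Κ oneₚ ⊜ ((t ⊗ tᵇ) ⊗ (Κ oneₚ ⊕ u ⊗ F))) ≈-refl

digitFactor-+ : ∀ μ₀ N ν → digitFactor (suc μ₀) (N + ν) ≈
  tₚ ^ₚ ν *ₚ digitFactor (suc μ₀) N +ₚ (tₚ ^ₚ N *ₚ (tₚ ^ₚ μ₀) ^ₚ N) *ₚ (tₚ ^ₚ (μ₀ + ν) *ₚ (fₚ ν ∘ₚ (tₚ ^ₚ μ₀)))
digitFactor-+ μ₀ N ν = begin
  tₚ ^ₚ (N + ν) *ₚ (fₚ (N + ν + 1) ∘ₚ u)
    ≈⟨ *-cong (^-distribˡ-+-* tₚ N ν) (≈-reflexive (cong (λ x → fₚ x ∘ₚ u) (swap-last N ν 1))) ⟩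
  tᴺ⁺ᵛ *ₚ (fₚ ((N + 1) + ν) ∘ₚ u)
    ≈⟨ *-congˡ tᴺ⁺ᵛ (fₚ∘-+ u (N + 1) ν) ⟩
  tᴺ⁺ᵛ *ₚ (fₚ (N + 1) ∘ₚ u +ₚ u ^ₚ (N + 1) *ₚ (fₚ ν ∘ₚ u))
    ≈⟨ *-congˡ tᴺ⁺ᵛ (+-congˡ (fₚ (N + 1) ∘ₚ u) (*-congʳ (fₚ ν ∘ₚ u) (^-distribˡ-+-* u N 1))) ⟩
  tᴺ⁺ᵛ *ₚ (fₚ (N + 1) ∘ₚ u +ₚ (u ^ₚ N *ₚ (u *ₚ oneₚ)) *ₚ (fₚ ν ∘ₚ u))
    ≈⟨ regroup (tₚ ^ₚ N) (tₚ ^ₚ ν) (fₚ (N + 1) ∘ₚ u) u (u ^ₚ N) (fₚ ν ∘ₚ u) ⟩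
  tₚ ^ₚ ν *ₚ digitFactor (suc μ₀) N +ₚ (tₚ ^ₚ N *ₚ u ^ₚ N) *ₚ ((u *ₚ tₚ ^ₚ ν) *ₚ (fₚ ν ∘ₚ u))
    ≈⟨ +-congˡ (tₚ ^ₚ ν *ₚ digitFactor (suc μ₀) N)
         (*-congˡ (tₚ ^ₚ N *ₚ u ^ₚ N) (*-congʳ (fₚ ν ∘ₚ u) (^-distribˡ-+-* tₚ μ₀ ν))) ⟨
  tₚ ^ₚ ν *ₚ digitFactor (suc μ₀) N +ₚ (tₚ ^ₚ N *ₚ u ^ₚ N) *ₚ (tₚ ^ₚ (μ₀ + ν) *ₚ (fₚ ν ∘ₚ u)) ∎
  where
  open SetoidReasoning ≈-setoid
  u    = tₚ ^ₚ μ₀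
  tᴺ⁺ᵛ = tₚ ^ₚ N *ₚ tₚ ^ₚ ν
  swap-last : ∀ a b c → a + b + c ≡ a + c + b
  swap-last = ℕ-Solver.solve-∀
  regroup : ∀ a b F u c G →
    (a *ₚ b) *ₚ (F +ₚ (c *ₚ (u *ₚ oneₚ)) *ₚ G) ≈ b *ₚ (a *ₚ F) +ₚ (a *ₚ c) *ₚ ((u *ₚ b) *ₚ G)
  regroup = solve 6 (λ a b F u c G →
    (a ⊗ b) ⊗ (F ⊕ (c ⊗ (u ⊗ Κ oneₚ)) ⊗ G) ⊜ (b ⊗ (a ⊗ F) ⊕ (a ⊗ c) ⊗ ((u ⊗ b) ⊗ G))) ≈-refl

digitFactor-periodic : ∀ {g} μ ν → 1 ≤ μ → g ∣ tₚ ^ₚ (μ + ν ∸ 1) *ₚ (fₚ ν ∘ₚ (tₚ ^ₚ (μ ∸ 1))) →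
  ∀ a l → digitFactor μ (a + l * ν) ≈ (tₚ ^ₚ ν) ^ₚ l *ₚ digitFactor μ a [mod g ]
digitFactor-periodic μ ν _ _ a zero = ≈⇒≈[mod] (≈-trans
  (≈-reflexive (cong (digitFactor μ) (ℕP.+-identityʳ a))) (≈-sym (*-identityˡ _)))
digitFactor-periodic {g} (suc μ₀) ν 1≤μ g∣G a (suc l) = begin
  digitFactor μ (a + (ν + l * ν))  ≡⟨ cong (digitFactor μ) (reorder a ν l) ⟩
  digitFactor μ (N + ν)            ≈⟨ digitFactor-+ μ₀ N ν ⟩
  T *ₚ digitFactor μ N +ₚ (tₚ ^ₚ N *ₚ u ^ₚ N) *ₚ (tₚ ^ₚ (μ₀ + ν) *ₚ (fₚ ν ∘ₚ u))
    ≲⟨ +-multiple-mod g∣G (T *ₚ digitFactor μ N) (tₚ ^ₚ N *ₚ u ^ₚ N) ⟩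
  T *ₚ digitFactor μ N
    ≲⟨ *-congˡ-mod T (digitFactor-periodic μ ν 1≤μ g∣G a l) ⟩
  T *ₚ (T ^ₚ l *ₚ digitFactor μ a)
    ≈⟨ *-assoc T (T ^ₚ l) (digitFactor μ a) ⟨
  T ^ₚ suc l *ₚ digitFactor μ a    ∎
  where
  open PreorderReasoning (≈[mod]-preorder {g})
  μ = suc μ₀
  N = a + l * ν
  T = tₚ ^ₚ ν
  u = tₚ ^ₚ μ₀
  reorder : ∀ a ν l → a + (ν + l * ν) ≡ (a + l * ν) + ν
  reorder = ℕ-Solver.solve-∀

digitProduct : (ℕ → ℕ) → (ℕ → ℕ) → ℕ → Poly
digitProduct m a k = tₚ ^ₚ a 0 *ₚ prod1ₚ k (λ j → digitFactor (m j) (a j))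

-- Mixed-radix expansions

place-value-< : ∀ {S X d μ} → S < X → d < μ → S + d * X < X * μ
place-value-< {S} {X} {d} {μ} S<X d<μ = begin-strict
  S + d * X  <⟨ ℕP.+-monoˡ-< (d * X) S<X ⟩
  suc d * X  ≤⟨ ℕP.*-monoˡ-≤ X d<μ ⟩
  μ * X      ≡⟨ ℕP.*-comm μ X ⟩
  X * μ      ∎
  where open ℕP.≤-Reasoning

module _ (m : ℕ → ℕ) where

  Mseq-mono : (∀ i → 0 < m i) → ∀ {j i} → j ≤′ i → Mseq m j ≤ Mseq m i
  Mseq-mono pos (≤′-reflexive refl) = ℕP.≤-refl
  Mseq-mono pos {i = suc i} (≤′-step j≤′i) =
    ℕP.≤-trans (Mseq-mono pos j≤′i) (ℕP.m≤m*n (Mseq m i) (m (suc i)) {{>-nonZero (pos (suc i))}})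

  n<Mseq : 0 < m 0 → (∀ i → 2 ≤ m (suc i)) → ∀ n → n < Mseq m n
  n<Mseq 0<m₀ 2≤m zero    = 0<m₀
  n<Mseq 0<m₀ 2≤m (suc n) = ℕP.≤-<-trans n<Mₙ
    (ℕP.m<m*n (Mseq m n) (m (suc n)) {{>-nonZero (ℕP.≤-<-trans z≤n n<Mₙ)}} (2≤m n))
    where
    n<Mₙ = n<Mseq 0<m₀ 2≤m n

  digits<Mseq : 0 < m 0 → ∀ k (a : ℕ → ℕ) → (∀ j → j ≤ k → a j < m (suc j)) →
    sumℕ≤ k (λ j → a j * Mseq m j) < Mseq m (suc k)
  digits<Mseq 0<m₀ zero    a a<m = place-value-< 0<m₀ (a<m 0 z≤n)
  digits<Mseq 0<m₀ (suc k) a a<m = place-value-<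
    (digits<Mseq 0<m₀ k a (λ j j≤k → a<m j (ℕP.m≤n⇒m≤1+n j≤k))) (a<m (suc k) ℕP.≤-refl)

  -- The partition polynomials

  P-summand : ℕ → ℕ → ℕ → Poly
  P-summand j n c = if does (c * Mseq m j ≤? n) then tₚ ^ₚ c *ₚ P m j (n ∸ c * Mseq m j) else zeroₚ

  P-summand-≤ : ∀ j n c → c * Mseq m j ≤ n → P-summand j n c ≡ tₚ ^ₚ c *ₚ P m j (n ∸ c * Mseq m j)
  P-summand-≤ j n c cM≤n rewrite dec-true (c * Mseq m j ≤? n) cM≤n = refl

  P-summand-> : ∀ j n c → n < c * Mseq m j → P-summand j n c ≡ []
  P-summand-> j n c n<cM rewrite dec-false (c * Mseq m j ≤? n) (ℕP.<⇒≱ n<cM) = refl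

  P-zero-pos : ∀ {n} → 0 < n → P m 0 n ≈ []
  P-zero-pos {suc n} _ = ≈-refl

  P-digits : ∀ j {r} → r < Mseq m j → ∀ b →
    P m (suc j) (r + b * Mseq m j) ≈ sumₚ (suc b) (λ c → tₚ ^ₚ c *ₚ P m j (r + (b ∸ c) * Mseq m j))
  P-digits j {r} r<M b = ≈-trans
    (sumₚ-zero-tail (ℕP.≤⇒≤′ (s≤s b≤n)) (λ c b<c _ → ≈-reflexive (P-summand-> j n c (n<cM b<c))))
    (sumₚ-cong +-isMagma (suc b) (λ c c<1+b → ≈-reflexive (summand-≤b (ℕP.≤-pred c<1+b))))
    where
    M = Mseq m j
    n = r + b * M
    instance _ = >-nonZero (ℕP.≤-<-trans z≤n r<M)
    b≤n : b ≤ n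
    b≤n = ℕP.≤-trans (ℕP.m≤m*n b M) (ℕP.m≤n+m (b * M) r)
    n<cM : ∀ {c} → b < c → n < c * M
    n<cM b<c = ℕP.<-≤-trans (ℕP.+-monoˡ-< (b * M) r<M) (ℕP.*-monoˡ-≤ M b<c)
    summand-≤b : ∀ {c} → c ≤ b → P-summand j n c ≡ tₚ ^ₚ c *ₚ P m j (r + (b ∸ c) * M)
    summand-≤b {c} c≤b = ≡.trans (P-summand-≤ j n c (ℕP.≤-trans cM≤bM (ℕP.m≤n+m (b * M) r)))
      (cong (λ x → tₚ ^ₚ c *ₚ P m j x)
        (≡.trans (ℕP.+-∸-assoc r cM≤bM) (cong (r +_) (≡.sym (ℕP.*-distribʳ-∸ M b c)))))
      where
      cM≤bM = ℕP.*-monoˡ-≤ M c≤b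

  P-one : 0 < m 0 → ∀ b → P m 1 (b * m 0) ≈ tₚ ^ₚ b
  P-one 0<m₀ b = begin
    P m 1 (b * m 0)
      ≈⟨ P-digits 0 0<m₀ b ⟩
    sumₚ b (λ c → tₚ ^ₚ c *ₚ P m 0 ((b ∸ c) * m 0)) +ₚ tₚ ^ₚ b *ₚ P m 0 ((b ∸ b) * m 0)
      ≈⟨ +-cong (sumₚ-zero-tail (ℕP.≤⇒≤′ z≤n) lower-terms)
                (*-congˡ (tₚ ^ₚ b) (≈-reflexive (cong (λ x → P m 0 (x * m 0)) (ℕP.n∸n≡0 b)))) ⟩
    tₚ ^ₚ b *ₚ oneₚ
      ≈⟨ *-identityʳ (tₚ ^ₚ b) ⟩
    tₚ ^ₚ b ∎
    where
    open SetoidReasoning ≈-setoid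
    lower-terms : ∀ c → 0 ≤ c → c < b → tₚ ^ₚ c *ₚ P m 0 ((b ∸ c) * m 0) ≈ []
    lower-terms c _ c<b = ≈-trans
      (*-congˡ (tₚ ^ₚ c) (P-zero-pos (ℕP.*-mono-≤ (ℕP.m<n⇒0<n∸m c<b) 0<m₀))) (*-zeroʳ (tₚ ^ₚ c))

  P-stable-step : ∀ j {n} → n < Mseq m j → P m (suc j) n ≈ P m j n
  P-stable-step j {n} n<M = ≡.subst (λ x → P m (suc j) x ≈ P m j x) (ℕP.+-identityʳ n)
    (≈-trans (P-digits j n<M 0) (*-identityˡ (P m j (n + 0))))

  P-stable : (∀ i → 0 < m i) → ∀ {j i n} → j ≤′ i → n < Mseq m j → P m i n ≈ P m j n
  P-stable pos (≤′-reflexive refl) n<M = ≈-refl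
  P-stable pos {i = suc i} (≤′-step j≤′i) n<M =
    ≈-trans (P-stable-step i (ℕP.<-≤-trans n<M (Mseq-mono pos j≤′i))) (P-stable pos j≤′i n<M)

  pM≈P : (∀ i → 0 < m i) → (∀ i → 2 ≤ m (suc i)) → ∀ j {n} → n < Mseq m j → pM m n ≈ P m j n
  pM≈P pos 2≤m j {n} n<M with ℕP.≤-total j (suc n)
  ... | inj₁ j≤1+n = P-stable pos (ℕP.≤⇒≤′ j≤1+n) n<M
  ... | inj₂ 1+n≤j = ≈-sym (P-stable pos (ℕP.≤⇒≤′ 1+n≤j) (ℕP.<⇒≤ (n<Mseq (pos 0) 2≤m (suc n))))

  P-next-digit : ∀ {g} j {r E} → 0 < m j → r < Mseq m j →
    (∀ l → P m j (r + l * Mseq m j) ≈ E *ₚ (tₚ ^ₚ m j) ^ₚ l [mod g ]) →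
    ∀ b → P m (suc j) (r + b * Mseq m j) ≈ E *ₚ digitFactor (m j) b [mod g ]
  P-next-digit {g} j {r} {E} 0<mⱼ r<M P≈ET^ b = begin
    P m (suc j) (r + b * M)
      ≈⟨ P-digits j r<M b ⟩
    sumₚ (suc b) (λ c → tₚ ^ₚ c *ₚ P m j (r + (b ∸ c) * M))
      ≲⟨ sumₚ-cong +-isMagma-mod (suc b) (λ c _ → *-congˡ-mod (tₚ ^ₚ c) (P≈ET^ (b ∸ c))) ⟩
    sumₚ (suc b) (λ c → tₚ ^ₚ c *ₚ (E *ₚ T ^ₚ (b ∸ c)))
      ≈⟨ sumₚ-cong +-isMagma (suc b) (λ c _ → *-swap (tₚ ^ₚ c) E (T ^ₚ (b ∸ c))) ⟩
    sumₚ (suc b) (λ c → E *ₚ (tₚ ^ₚ c *ₚ T ^ₚ (b ∸ c)))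
      ≈⟨ *-distribˡ-sumₚ E (suc b) (λ c → tₚ ^ₚ c *ₚ T ^ₚ (b ∸ c)) ⟨
    E *ₚ sumₚ (suc b) (λ c → tₚ ^ₚ c *ₚ T ^ₚ (b ∸ c))
      ≈⟨ *-congˡ E (sum≈digitFactor (m j) 0<mⱼ b) ⟩
    E *ₚ digitFactor (m j) b ∎
    where
    open PreorderReasoning (≈[mod]-preorder {g})
    M = Mseq m j
    T = tₚ ^ₚ m j

  P≈digitProduct : ∀ {g} (a : ℕ → ℕ) → (∀ i → 0 < m i) → ∀ k →
    (∀ h → 1 ≤ h → h ≤ k → g ∣ gArg m h) → (∀ j → j < k → a j < m (suc j)) → ∀ l →
    P m (suc k) (sumℕ≤ k (λ j → a j * Mseq m j) + l * Mseq m (suc k))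
      ≈ digitProduct m a k *ₚ (tₚ ^ₚ m (suc k)) ^ₚ l [mod g ]
  P≈digitProduct a pos zero _ _ l = ≈⇒≈[mod] (begin
    P m 1 (a 0 * m 0 + l * (m 0 * m 1))      ≡⟨ cong (P m 1) (factor (a 0) (m 0) l (m 1)) ⟩
    P m 1 ((a 0 + l * m 1) * m 0)            ≈⟨ P-one (pos 0) (a 0 + l * m 1) ⟩
    tₚ ^ₚ (a 0 + l * m 1)                    ≈⟨ ^-distribˡ-+-* tₚ (a 0) (l * m 1) ⟩
    tₚ ^ₚ a 0 *ₚ tₚ ^ₚ (l * m 1)             ≈⟨ *-cong (*-identityʳ (tₚ ^ₚ a 0)) (^-*-assoc tₚ (m 1) l) ⟨
    (tₚ ^ₚ a 0 *ₚ oneₚ) *ₚ (tₚ ^ₚ m 1) ^ₚ l  ∎)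
    where
    open SetoidReasoning ≈-setoid
    factor : ∀ a M l μ → a * M + l * (M * μ) ≡ (a + l * μ) * M
    factor = ℕ-Solver.solve-∀
  P≈digitProduct {g} a pos (suc k) g∣G a<m l = begin
    P m (suc (suc k)) ((S + a (suc k) * X) + l * (X * μ))
      ≡⟨ cong (P m (suc (suc k))) (regroup S (a (suc k)) l X μ) ⟩
    P m (suc (suc k)) (S + (a (suc k) + l * μ) * X)
      ≲⟨ P-next-digit (suc k) {E = D} (pos (suc k)) S<X P≈DT^ (a (suc k) + l * μ) ⟩
    D *ₚ digitFactor (m (suc k)) (a (suc k) + l * μ)
      ≲⟨ *-congˡ-mod D (digitFactor-periodic (m (suc k)) μ (pos (suc k)) g∣Gₖ₊₁ (a (suc k)) l) ⟩
    D *ₚ ((tₚ ^ₚ μ) ^ₚ l *ₚ digitFactor (m (suc k)) (a (suc k)))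
      ≈⟨ reassociate (tₚ ^ₚ a 0) (prod1ₚ k (λ j → digitFactor (m j) (a j))) _ _ ⟩
    digitProduct m a (suc k) *ₚ (tₚ ^ₚ μ) ^ₚ l ∎
    where
    open PreorderReasoning (≈[mod]-preorder {g})
    S = sumℕ≤ k (λ j → a j * Mseq m j)
    X = Mseq m (suc k)
    μ = m (suc (suc k))
    D = digitProduct m a k
    S<X : S < X
    S<X = digits<Mseq (pos 0) k a (λ j j≤k → a<m j (s≤s j≤k))
    P≈DT^ = P≈digitProduct a pos k (λ h 1≤h h≤k → g∣G h 1≤h (ℕP.m≤n⇒m≤1+n h≤k))
                                   (λ j j<k → a<m j (ℕP.m<n⇒m<1+n j<k))
    g∣Gₖ₊₁ = g∣G (suc k) (s≤s z≤n) ℕP.≤-refl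
    regroup : ∀ S d l X μ → (S + d * X) + l * (X * μ) ≡ S + (d + l * μ) * X
    regroup = ℕ-Solver.solve-∀
    reassociate : ∀ x p T h → (x *ₚ p) *ₚ (T *ₚ h) ≈ (x *ₚ (p *ₚ h)) *ₚ T
    reassociate = solve 4 (λ x p T h → (x ⊗ p) ⊗ (T ⊗ h) ⊜ ((x ⊗ (p ⊗ h)) ⊗ T)) ≈-refl

theorem5p3 : (m : ℕ → ℕ) → m 0 ≡ 1 → (∀ i → 1 ≤ i → 2 ≤ m i) →
    (n k : ℕ) → 1 ≤ k → (a : ℕ → ℕ) → (∀ j → j ≤ k → a j < m (suc j)) →
    n ≡ sumℕ≤ k (λ j → a j * Mseq m j) →
    (g : Poly) → IsGcdTo (gArg m) k g →
    pM m n ≡ (tₚ ^ₚ a 0) *ₚ prod1ₚ k (λ j → (tₚ ^ₚ a j) *ₚ (fₚ (a j + 1) ∘ₚ (tₚ ^ₚ (m j ∸ 1)))) [modₚ g ]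
theorem5p3 m m₀≡1 m≥2 n k _ a a<m refl g gcd = ≈[mod]⇒≡[modₚ] (begin
  pM m n                                ≈⟨ pM≈P m pos 2≤m (suc k) (digits<Mseq m (pos 0) k a a<m) ⟩
  P m (suc k) n                         ≡⟨ cong (P m (suc k)) (ℕP.+-identityʳ n) ⟨
  P m (suc k) (n + 0 * Mseq m (suc k))  ≲⟨ P≈digitProduct m a pos k g∣G (λ j → a<m j ∘ ℕP.<⇒≤) 0 ⟩
  digitProduct m a k *ₚ oneₚ            ≈⟨ *-identityʳ (digitProduct m a k) ⟩
  digitProduct m a k                    ∎)
  where
  open PreorderReasoning (≈[mod]-preorder {g})
  pos : ∀ i → 0 < m i
  pos zero    = ℕP.≤-reflexive (≡.sym m₀≡1)
  pos (suc i) = ℕP.<-trans (s≤s z≤n) (m≥2 (suc i) (s≤s z≤n))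
  2≤m : ∀ i → 2 ≤ m (suc i)
  2≤m i = m≥2 (suc i) (s≤s z≤n)
  g∣G : ∀ h → 1 ≤ h → h ≤ k → g ∣ gArg m h
  g∣G = IsGcdTo⇒∣ k gcd
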